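{- Let $\alpha$ be a c-normal prime $\mathbf{CNL_4^2}$-theory, and let $v^c:PV\to\mathscr U$ be the map such that for every $p\in PV$: $v^c(p)\in\mathcal D\iff p\in\alpha$ and $v^c(p)\in\mathcal A\iff{\sim}^{3}p\in\alpha$. Extend $v^c$ to all formulas as a $\mathbf{CNL_4^2}$-valuation. Then for every formula $A$: (1) $v^c(A)\in\mathcal D\iff A\in\alpha$; (2) $v^c(A)\in\mathcal A\iff{\sim}^{3}A\in\alpha$.
   Context: Formulas are built from a countable set $PV$ of variables with binary $\wedge,\vee$ and unary ${\sim}$; ${\sim}^{n}A$ denotes $n$-fold application of ${\sim}$. $\mathscr U=\{\mathbf T,\mathbf{TU},\mathbf{FU},\mathbf F\}$ ordered as lattice $4\mathcal Q$ ($\mathbf T$ top, $\mathbf F$ bottom, $\mathbf{TU},\mathbf{FU}$ incomparable); $f_{\sim}$: $\mathbf T\mapsto\mathbf{TU}$, $\mathbf{TU}\mapsto\mathbf F$, $\mathbf F\mapsto\mathbf{FU}$, $\mathbf{FU}\mapsto\mathbf T$; $\mathcal D=\{\mathbf T,\mathbf{TU}\}$, $\mathcal A=\{\mathbf{TU},\mathbf F\}$ (each element of $\mathscr U$ is determined by its membership in $\mathcal D$ and in $\mathcal A$, so $v^c$ is well defined on variables). A $\mathbf{CNL_4^2}$-valuation extends a map $PV\to\mathscr U$ by interpreting $\wedge,\vee$ as meet/join in $4\mathcal Q$ and ${\sim}$ as $f_{\sim}$. The calculus $\mathbf{CNL_4^2}$ (on sequents $A\vdash B$) has axiom schemata (a1)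 $A\wedge B\vdash A$; (a2) $A\wedge B\vdash B$; (a3) $B\vdash A\vee B$; (a4) $A\vdash A\vee B$; (a5) $A\vdash{\sim}^{4}A$; (a6) ${\sim}^{4}A\vdash A$; (a7) ${\sim}A\wedge{\sim}B\vdash{\sim}(A\wedge B)$; (a8) ${\sim}(A\vee B)\vdash{\sim}A\vee{\sim}B$; (a9) $A\wedge{\sim}^{2}A\vdash B$; (a10) $A\wedge(B\vee C)\vdash(A\wedge B)\vee(A\wedge C)$; (b1) ${\sim}(A\wedge B)\vdash{\sim}A\wedge{\sim}B$; (b2) ${\sim}A\vee{\sim}B\vdash{\sim}(A\vee B)$; and rules (r1) $A\vdash B$, $B\vdash C$ / $A\vdash C$; (r2) $A\vdash B$, $A\vdash C$ / $A\vdash B\wedge C$; (r3) $A\vdash C$, $B\vdash C$ / $A\vee B\vdash C$; (r4) $A\vdash B$ / ${\sim}^{2}B\vdash{\sim}^{2}A$; provability as usual (finite list of axioms and rule applications). A $\mathbf{CNL_4^2}$-theory is a set $\alpha$ of formulas closed under $\wedge$ (if $A,B\in\alpha$ then $A\wedge B\in\alpha$) and under provable sequents (if $A\in\alpha$ and $A\vdash B$ provable then $B\in\alpha$); prime if $A\vee B\in\alpha$ implies $A\in\alpha$ or $B\in\alpha$; c-normal if for all $A$: $A\in\alpha$ iff ${\sim}^{2}A\notin\alpha$. -}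

module Defs where

open import Data.Nat using (ℕ; zero; suc)
open import Data.Product using (_×_)
open import Data.Sum using (_⊎_)
open import Relation.Nullary using (¬_)
open import Relation.Binary.PropositionalEquality using (_≡_)
open import Function.Bundles using (_⇔_)

PV : Set
PV = ℕ

infixr 6 _∧_
infixr 5 _∨_

data Formula : Set where
  var : PV → Formula
  _∧_ : Formula → Formula → Formula
  _∨_ : Formula → Formula → Formula
  ∼_  : Formula → Formula

∼^ : ℕ → Formula → Formula
∼^ zero    A = A
∼^ (suc n) A = ∼ (∼^ n A)

data 𝓤 : Set where
  T TU FU F : 𝓤

-- lattice 4Q: T top, F bottom, TU and FU incomparable
_⊓_ : 𝓤 → 𝓤 → 𝓤
T  ⊓ y  = y
F  ⊓ y  = F
TU ⊓ T  = TU
TU ⊓ TU = TU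
TU ⊓ FU = F
TU ⊓ F  = F
FU ⊓ T  = FU
FU ⊓ TU = F
FU ⊓ FU = FU
FU ⊓ F  = F

_⊔_ : 𝓤 → 𝓤 → 𝓤
T  ⊔ y  = T
F  ⊔ y  = y
TU ⊔ T  = T
TU ⊔ TU = TU
TU ⊔ FU = T
TU ⊔ F  = TU
FU ⊔ T  = T
FU ⊔ TU = T
FU ⊔ FU = FU
FU ⊔ F  = FU

f∼ : 𝓤 → 𝓤
f∼ T  = TU
f∼ TU = F
f∼ F  = FU
f∼ FU = T

data 𝒟 : 𝓤 → Set where
  d-T  : 𝒟 T
  d-TU : 𝒟 TU

data 𝒜 : 𝓤 → Set where
  a-TU : 𝒜 TU
  a-F  : 𝒜 F

⟦_⟧ : Formula → (PV → 𝓤) → 𝓤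
⟦ var p ⟧ v = v p
⟦ A ∧ B ⟧ v = ⟦ A ⟧ v ⊓ ⟦ B ⟧ v
⟦ A ∨ B ⟧ v = ⟦ A ⟧ v ⊔ ⟦ B ⟧ v
⟦ ∼ A ⟧   v = f∼ (⟦ A ⟧ v)

infix 3 _⊢_
data _⊢_ : Formula → Formula → Set where
  a1  : ∀ {A B} → A ∧ B ⊢ A
  a2  : ∀ {A B} → A ∧ B ⊢ B
  a3  : ∀ {A B} → B ⊢ A ∨ B
  a4  : ∀ {A B} → A ⊢ A ∨ B
  a5  : ∀ {A} → A ⊢ ∼^ 4 A
  a6  : ∀ {A} → ∼^ 4 A ⊢ A
  a7  : ∀ {A B} → (∼ A) ∧ (∼ B) ⊢ ∼ (A ∧ B)
  a8  : ∀ {A B} → ∼ (A ∨ B) ⊢ (∼ A) ∨ (∼ B)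
  a9  : ∀ {A B} → A ∧ ∼^ 2 A ⊢ B
  a10 : ∀ {A B C} → A ∧ (B ∨ C) ⊢ (A ∧ B) ∨ (A ∧ C)
  b1  : ∀ {A B} → ∼ (A ∧ B) ⊢ (∼ A) ∧ (∼ B)
  b2  : ∀ {A B} → (∼ A) ∨ (∼ B) ⊢ ∼ (A ∨ B)
  r1  : ∀ {A B C} → A ⊢ B → B ⊢ C → A ⊢ C
  r2  : ∀ {A B C} → A ⊢ B → A ⊢ C → A ⊢ B ∧ C
  r3  : ∀ {A B C} → A ⊢ C → B ⊢ C → A ∨ B ⊢ C
  r4  : ∀ {A B} → A ⊢ B → ∼^ 2 B ⊢ ∼^ 2 A

FSet : Set₁
FSet = Formula → Set

record IsTheory (α : FSet) : Set where
  field
    ∧-closed : ∀ {A B} → α A → α B → α (A ∧ B)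
    ⊢-closed : ∀ {A B} → α A → A ⊢ B → α B

IsPrime : FSet → Set
IsPrime α = ∀ {A B} → α (A ∨ B) → α A ⊎ α B

IsCNormal : FSet → Set
IsCNormal α = ∀ A → α A ⇔ (¬ α (∼^ 2 A))

{-# OPTIONS --safe #-}
-- The four values are determined by membership in 𝒟 and 𝒜, and 𝒟 is a prime
-- filter and 𝒜 a prime ideal of 4Q; moreover f∼ x lies in 𝒜 iff x ∈ 𝒟, and in
-- 𝒟 iff x ∉ 𝒜.  On the syntactic side a prime theory is a prime filter of
-- formulas, and ∼³ turns ∧ into ∨ and ∨ into ∧ up to interderivability (∼² is
-- an antitone involution by r4, a5 and a6).  c-normality makes α (∼ A) the
-- complement of α (∼³ A), matching 𝒟 (f∼ x) ⇔ ¬ 𝒜 x, and a5/a6 identify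
-- ∼³ (∼ A) with A.  So both equivalences propagate by induction on A.
module Submission where

open import Defs
open import Data.Product using (_×_; _,_; proj₁; proj₂)
open import Data.Product.Function.NonDependent.Propositional using (_×-⇔_)
open import Data.Sum using (_⊎_; inj₁; inj₂; [_,_])
open import Data.Sum.Function.Propositional using (_⊎-⇔_)
open import Data.Empty using (⊥-elim)
open import Relation.Nullary using (¬_)
open import Function.Bundles using (_⇔_; mk⇔)
open import Function.Properties.Equivalence using () renaming (sym to ⇔-sym)
open import Function.Related.TypeIsomorphisms using (¬-cong-⇔)
open import Function.Related.Propositional using (module EquationalReasoning)

open EquationalReasoning

𝒟-⊓ : ∀ x y → 𝒟 (x ⊓ y) ⇔ (𝒟 x × 𝒟 y)
𝒟-⊓ T  y  = mk⇔ (d-T ,_) proj₂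
𝒟-⊓ F  y  = mk⇔ (λ ()) (λ { (() , _) })
𝒟-⊓ TU T  = mk⇔ (_, d-T) proj₁
𝒟-⊓ TU TU = mk⇔ (λ d → d , d) proj₁
𝒟-⊓ TU FU = mk⇔ (λ ()) (λ { (_ , ()) })
𝒟-⊓ TU F  = mk⇔ (λ ()) (λ { (_ , ()) })
𝒟-⊓ FU T  = mk⇔ (λ ()) (λ { (() , _) })
𝒟-⊓ FU TU = mk⇔ (λ ()) (λ { (() , _) })
𝒟-⊓ FU FU = mk⇔ (λ ()) (λ { (() , _) })
𝒟-⊓ FU F  = mk⇔ (λ ()) (λ { (() , _) })

𝒟-⊔ : ∀ x y → 𝒟 (x ⊔ y) ⇔ (𝒟 x ⊎ 𝒟 y)
𝒟-⊔ T  y  = mk⇔ (λ _ → inj₁ d-T) (λ _ → d-T)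
𝒟-⊔ F  y  = mk⇔ inj₂ [ (λ ()) , (λ d → d) ]
𝒟-⊔ TU T  = mk⇔ (λ _ → inj₁ d-TU) (λ _ → d-T)
𝒟-⊔ TU TU = mk⇔ inj₁ [ (λ d → d) , (λ d → d) ]
𝒟-⊔ TU FU = mk⇔ (λ _ → inj₁ d-TU) (λ _ → d-T)
𝒟-⊔ TU F  = mk⇔ inj₁ [ (λ d → d) , (λ ()) ]
𝒟-⊔ FU T  = mk⇔ inj₂ (λ _ → d-T)
𝒟-⊔ FU TU = mk⇔ (λ _ → inj₂ d-TU) (λ _ → d-T)
𝒟-⊔ FU FU = mk⇔ (λ ()) [ (λ ()) , (λ ()) ]
𝒟-⊔ FU F  = mk⇔ (λ ()) [ (λ ()) , (λ ()) ]

𝒜-⊓ : ∀ x y → 𝒜 (x ⊓ y) ⇔ (𝒜 x ⊎ 𝒜 y)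
𝒜-⊓ T  y  = mk⇔ inj₂ [ (λ ()) , (λ a → a) ]
𝒜-⊓ F  y  = mk⇔ (λ _ → inj₁ a-F) (λ _ → a-F)
𝒜-⊓ TU T  = mk⇔ inj₁ [ (λ a → a) , (λ ()) ]
𝒜-⊓ TU TU = mk⇔ inj₁ [ (λ a → a) , (λ a → a) ]
𝒜-⊓ TU FU = mk⇔ (λ _ → inj₁ a-TU) (λ _ → a-F)
𝒜-⊓ TU F  = mk⇔ (λ _ → inj₁ a-TU) (λ _ → a-F)
𝒜-⊓ FU T  = mk⇔ (λ ()) [ (λ ()) , (λ ()) ]
𝒜-⊓ FU TU = mk⇔ (λ _ → inj₂ a-TU) (λ _ → a-F)
𝒜-⊓ FU FU = mk⇔ (λ ()) [ (λ ()) , (λ ()) ]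
𝒜-⊓ FU F  = mk⇔ inj₂ (λ _ → a-F)

𝒜-⊔ : ∀ x y → 𝒜 (x ⊔ y) ⇔ (𝒜 x × 𝒜 y)
𝒜-⊔ T  y  = mk⇔ (λ ()) (λ { (() , _) })
𝒜-⊔ F  y  = mk⇔ (a-F ,_) proj₂
𝒜-⊔ TU T  = mk⇔ (λ ()) (λ { (_ , ()) })
𝒜-⊔ TU TU = mk⇔ (λ a → a , a) proj₁
𝒜-⊔ TU FU = mk⇔ (λ ()) (λ { (_ , ()) })
𝒜-⊔ TU F  = mk⇔ (_, a-F) proj₁
𝒜-⊔ FU T  = mk⇔ (λ ()) (λ { (() , _) })
𝒜-⊔ FU TU = mk⇔ (λ ()) (λ { (() , _) })
𝒜-⊔ FU FU = mk⇔ (λ ()) (λ { (() , _) })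
𝒜-⊔ FU F  = mk⇔ (λ ()) (λ { (() , _) })

𝒟-f∼ : ∀ x → 𝒟 (f∼ x) ⇔ (¬ 𝒜 x)
𝒟-f∼ T  = mk⇔ (λ _ ()) (λ _ → d-TU)
𝒟-f∼ TU = mk⇔ (λ ()) (λ ¬a → ⊥-elim (¬a a-TU))
𝒟-f∼ FU = mk⇔ (λ _ ()) (λ _ → d-T)
𝒟-f∼ F  = mk⇔ (λ ()) (λ ¬a → ⊥-elim (¬a a-F))

𝒜-f∼ : ∀ x → 𝒜 (f∼ x) ⇔ 𝒟 x
𝒜-f∼ T  = mk⇔ (λ _ → d-T) (λ _ → a-TU)
𝒜-f∼ TU = mk⇔ (λ _ → d-TU) (λ _ → a-F)
𝒜-f∼ FU = mk⇔ (λ ()) (λ ())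
𝒜-f∼ F  = mk⇔ (λ ()) (λ ())

infix 3 _⊣⊢_
_⊣⊢_ : Formula → Formula → Set
A ⊣⊢ B = (A ⊢ B) × (B ⊢ A)

⊣⊢-sym : ∀ {A B} → A ⊣⊢ B → B ⊣⊢ A
⊣⊢-sym (A⊢B , B⊢A) = B⊢A , A⊢B

⊣⊢-trans : ∀ {A B C} → A ⊣⊢ B → B ⊣⊢ C → A ⊣⊢ C
⊣⊢-trans (A⊢B , B⊢A) (B⊢C , C⊢B) = r1 A⊢B B⊢C , r1 C⊢B B⊢A

∼⁴-⊣⊢ : ∀ {A} → ∼^ 4 A ⊣⊢ A
∼⁴-⊣⊢ = a6 , a5

∼²-cong : ∀ {A B} → A ⊣⊢ B → ∼^ 2 A ⊣⊢ ∼^ 2 B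
∼²-cong (A⊢B , B⊢A) = r4 B⊢A , r4 A⊢B

∼²-contraposeʳ : ∀ {A B} → A ⊢ ∼^ 2 B → B ⊢ ∼^ 2 A
∼²-contraposeʳ A⊢∼²B = r1 a5 (r4 A⊢∼²B)

∼²-contraposeˡ : ∀ {A B} → ∼^ 2 A ⊢ B → ∼^ 2 B ⊢ A
∼²-contraposeˡ ∼²A⊢B = r1 (r4 ∼²A⊢B) a6

∼-∧ : ∀ {A B} → ∼ (A ∧ B) ⊣⊢ ∼ A ∧ ∼ B
∼-∧ = b1 , a7

∼-∨ : ∀ {A B} → ∼ (A ∨ B) ⊣⊢ ∼ A ∨ ∼ B
∼-∨ = a8 , b2

∼²-∧ : ∀ {A B} → ∼^ 2 (A ∧ B) ⊣⊢ ∼^ 2 A ∨ ∼^ 2 B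
∼²-∧ = ∼²-contraposeˡ (r2 (∼²-contraposeˡ a4) (∼²-contraposeˡ a3)) , r3 (r4 a1) (r4 a2)

∼²-∨ : ∀ {A B} → ∼^ 2 (A ∨ B) ⊣⊢ ∼^ 2 A ∧ ∼^ 2 B
∼²-∨ = r2 (r4 a4) (r4 a3) , ∼²-contraposeʳ (r3 (∼²-contraposeʳ a1) (∼²-contraposeʳ a2))

∼³-∧ : ∀ {A B} → ∼^ 3 (A ∧ B) ⊣⊢ ∼^ 3 A ∨ ∼^ 3 B
∼³-∧ = ⊣⊢-trans (∼²-cong ∼-∧) ∼²-∧

∼³-∨ : ∀ {A B} → ∼^ 3 (A ∨ B) ⊣⊢ ∼^ 3 A ∧ ∼^ 3 B
∼³-∨ = ⊣⊢-trans (∼²-cong ∼-∨) ∼²-∨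

module TheoryProperties {α : FSet} (theory : IsTheory α) where
  open IsTheory theory

  ∈-⊣⊢ : ∀ {A B} → A ⊣⊢ B → α A ⇔ α B
  ∈-⊣⊢ (A⊢B , B⊢A) = mk⇔ (λ A∈α → ⊢-closed A∈α A⊢B) (λ B∈α → ⊢-closed B∈α B⊢A)

  ∈-∧ : ∀ {A B} → α (A ∧ B) ⇔ (α A × α B)
  ∈-∧ = mk⇔ (λ A∧B∈α → ⊢-closed A∧B∈α a1 , ⊢-closed A∧B∈α a2)
            (λ (A∈α , B∈α) → ∧-closed A∈α B∈α)

  ∈-∨ : IsPrime α → ∀ {A B} → α (A ∨ B) ⇔ (α A ⊎ α B)
  ∈-∨ prime = mk⇔ prime [ (λ A∈α → ⊢-closed A∈α a4) , (λ B∈α → ⊢-closed B∈α a3) ]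

Agrees : FSet → 𝓤 → Formula → Set
Agrees α x A = (𝒟 x ⇔ α A) × (𝒜 x ⇔ α (∼^ 3 A))

module _ {α : FSet} (theory : IsTheory α) where
  open TheoryProperties theory

  agrees-∧ : IsPrime α → ∀ {x y A B} → Agrees α x A → Agrees α y B → Agrees α (x ⊓ y) (A ∧ B)
  agrees-∧ prime {x} {y} {A} {B} (x𝒟 , x𝒜) (y𝒟 , y𝒜) =
    (begin
      𝒟 (x ⊓ y)    ∼⟨ 𝒟-⊓ x y ⟩
      (𝒟 x × 𝒟 y)  ∼⟨ x𝒟 ×-⇔ y𝒟 ⟩
      (α A × α B)  ∼⟨ ⇔-sym ∈-∧ ⟩
      α (A ∧ B)    ∎) ,
    (begin
      𝒜 (x ⊓ y)                  ∼⟨ 𝒜-⊓ x y ⟩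
      (𝒜 x ⊎ 𝒜 y)                ∼⟨ x𝒜 ⊎-⇔ y𝒜 ⟩
      (α (∼^ 3 A) ⊎ α (∼^ 3 B))  ∼⟨ ⇔-sym (∈-∨ prime) ⟩
      α (∼^ 3 A ∨ ∼^ 3 B)        ∼⟨ ∈-⊣⊢ (⊣⊢-sym ∼³-∧) ⟩
      α (∼^ 3 (A ∧ B))           ∎)

  agrees-∨ : IsPrime α → ∀ {x y A B} → Agrees α x A → Agrees α y B → Agrees α (x ⊔ y) (A ∨ B)
  agrees-∨ prime {x} {y} {A} {B} (x𝒟 , x𝒜) (y𝒟 , y𝒜) =
    (begin
      𝒟 (x ⊔ y)    ∼⟨ 𝒟-⊔ x y ⟩
      (𝒟 x ⊎ 𝒟 y)  ∼⟨ x𝒟 ⊎-⇔ y𝒟 ⟩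
      (α A ⊎ α B)  ∼⟨ ⇔-sym (∈-∨ prime) ⟩
      α (A ∨ B)    ∎) ,
    (begin
      𝒜 (x ⊔ y)                  ∼⟨ 𝒜-⊔ x y ⟩
      (𝒜 x × 𝒜 y)                ∼⟨ x𝒜 ×-⇔ y𝒜 ⟩
      (α (∼^ 3 A) × α (∼^ 3 B))  ∼⟨ ⇔-sym ∈-∧ ⟩
      α (∼^ 3 A ∧ ∼^ 3 B)        ∼⟨ ∈-⊣⊢ (⊣⊢-sym ∼³-∨) ⟩
      α (∼^ 3 (A ∨ B))           ∎)

  agrees-∼ : IsCNormal α → ∀ {x A} → Agrees α x A → Agrees α (f∼ x) (∼ A)
  agrees-∼ cnormal {x} {A} (x𝒟 , x𝒜) =
    (begin
      𝒟 (f∼ x)      ∼⟨ 𝒟-f∼ x ⟩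
      ¬ 𝒜 x         ∼⟨ ¬-cong-⇔ x𝒜 ⟩
      ¬ α (∼^ 3 A)  ∼⟨ ⇔-sym (cnormal (∼ A)) ⟩
      α (∼ A)       ∎) ,
    (begin
      𝒜 (f∼ x)    ∼⟨ 𝒜-f∼ x ⟩
      𝒟 x         ∼⟨ x𝒟 ⟩
      α A         ∼⟨ ∈-⊣⊢ (⊣⊢-sym ∼⁴-⊣⊢) ⟩
      α (∼^ 4 A)  ∎)

mainTheorem8 : (α : FSet) → IsTheory α → IsPrime α → IsCNormal α →
    (vᶜ : PV → 𝓤) →
    (∀ p → (𝒟 (vᶜ p) ⇔ α (var p)) × (𝒜 (vᶜ p) ⇔ α (∼^ 3 (var p)))) →
    ∀ A → (𝒟 (⟦ A ⟧ vᶜ) ⇔ α A) × (𝒜 (⟦ A ⟧ vᶜ) ⇔ α (∼^ 3 A))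
mainTheorem8 α theory prime cnormal vᶜ atoms = agrees
  where
  agrees : ∀ A → Agrees α (⟦ A ⟧ vᶜ) A
  agrees (var p) = atoms p
  agrees (A ∧ B) = agrees-∧ theory prime (agrees A) (agrees B)
  agrees (A ∨ B) = agrees-∨ theory prime (agrees A) (agrees B)
  agrees (∼ A)   = agrees-∼ theory cnormal (agrees A)
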